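{- $$1\le\liminf_{j\to+\infty}\frac{\log p^{(j)}_j}{j\log j}\le\limsup_{j\to+\infty}\frac{\log p^{(j)}_j}{j\log j}\le2.$$
   Context: Let $p_n$ denote the $n$-th prime number ($p_1=2$). Define $p^{(0)}_n=n$ and recursively $p^{(k+1)}_n=p_{p^{(k)}_n}$ for $k\in\mathbb N_0$. -}

module Defs where

open import Data.Nat using (ℕ; zero; suc)
open import Data.Nat.Primality using (Prime; prime?)
open import Data.List using (length; filter; upTo)
open import Data.Product using (_×_)
open import Relation.Binary.PropositionalEquality using (_≡_)

primeCount : ℕ → ℕ
primeCount m = length (filter prime? (upTo (suc m)))

-- q is the n-th prime (p_1 = 2): q is prime and exactly n primes are ≤ q
IsNthPrime : ℕ → ℕ → Set
IsNthPrime n q = Prime q × primeCount q ≡ n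

iter : (ℕ → ℕ) → ℕ → ℕ → ℕ
iter f zero n = n
iter f (suc k) n = f (iter f k n)

-- Lower bound: Chebyshev's estimate θ(x) ≤ 16^x for the primorial θ, together with (π(x)+1)! ≤ θ(x),
-- gives p_m ≥ t·m as soon as m ≥ 2·256^t.  Hence the k-th step of the iteration multiplies by at least
-- k, so p^(j)_j ≥ j!, and j! ≥ j^((1-1/b)·j) for large j.
-- Upper bound: every prime power dividing binom(2n,n) is at most 2n (Kummer), so 2^n ≤ binom(2n,n)
-- ≤ (2n)^π(2n).  This gives p_m ≤ m·j² whenever m ≤ j^(2j+1), hence p^(k)_j ≤ j^(2k+1) for k ≤ j.
module Submission where

open import Defs
open import Data.Nat.Base
open import Data.Nat.Properties
open import Algebra.Properties.CommutativeSemigroup *-commutativeSemigroup using (x∙yz≈y∙xz)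
open import Data.Nat.Divisibility
open import Data.Nat.DivMod using (_/_; _%_; m/n*n≡m; m≡m%n+[m/n]*n; m%n<n)
open import Data.Nat.Induction using (<-rec)
open import Data.Nat.Primality using (Prime; prime?; euclidsLemma; prime⇒nonTrivial; prime⇒nonZero)
open import Data.Nat.Primality.Factorisation using (factorise)
open import Data.Nat.Combinatorics using (_C_; nCk≡n!/k![n-k]!; k![n∸k]!∣n!; nCk+nC[k+1]≡[n+1]C[k+1])
open import Data.Nat.ListAction using (product)
open import Data.Nat.ListAction.Properties using (product-++)
open import Data.Nat.Tactic.RingSolver using (solve-∀)
open import Data.List using (List; []; _∷_; _++_; length; filter; upTo)
open import Data.List.Properties using (length-++; filter-++; filter-accept; filter-reject; upTo-∷ʳ; ++-identityʳ)
open import Data.List.Relation.Unary.All using (_∷_)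
open import Data.Sum using (_⊎_; inj₁; inj₂; [_,_]′)
open import Data.Product using (_×_; _,_; proj₁; proj₂; ∃-syntax)
open import Data.Empty using (⊥-elim)
open import Relation.Nullary using (¬_; yes; no)
open import Relation.Binary.PropositionalEquality

prime⇒≥2 : ∀ {p} → Prime p → 2 ≤ p
prime⇒≥2 {p} pp = nonTrivial⇒n>1 p {{prime⇒nonTrivial pp}}

prime∤1 : ∀ {p} → Prime p → ¬ (p ∣ 1)
prime∤1 pp p∣1 = <⇒≱ (prime⇒≥2 pp) (≤-reflexive (∣1⇒≡1 p∣1))

prime∣n!⇒≤ : ∀ {p} → Prime p → ∀ n → p ∣ n ! → p ≤ n
prime∣n!⇒≤ pp zero    p∣1  = ⊥-elim (prime∤1 pp p∣1)
prime∣n!⇒≤ pp (suc n) p∣n! with euclidsLemma (suc n) (n !) pp p∣n!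
... | inj₁ p∣1+n = ∣⇒≤ p∣1+n
... | inj₂ p∣n!′ = m≤n⇒m≤1+n (prime∣n!⇒≤ pp n p∣n!′)

m≤n⇒m∣n! : ∀ {m n} → 1 ≤ m → m ≤ n → m ∣ n !
m≤n⇒m∣n! {suc m} _ m≤n = ∣-trans (m∣m*n (m !)) (m≤n⇒m!∣n! m≤n)

[1+s]^d≤[s+d]! : ∀ s d → suc s ^ d ≤ (s + d) !
[1+s]^d≤[s+d]! s zero    = 1≤n! (s + 0)
[1+s]^d≤[s+d]! s (suc d) = begin
  suc s * suc s ^ d      ≤⟨ *-mono-≤ (s≤s (m≤m+n s d)) ([1+s]^d≤[s+d]! s d) ⟩
  suc (s + d) * (s + d) ! ≡⟨ cong _! (+-suc s d) ⟨
  (s + suc d) !          ∎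
  where open ≤-Reasoning

^-cancelˡ-≤ : ∀ a {m n} → 1 < a → a ^ m ≤ a ^ n → m ≤ n
^-cancelˡ-≤ a 1<a a^m≤a^n = ≮⇒≥ λ n<m → <⇒≱ (^-monoʳ-< a 1<a n<m) a^m≤a^n

^-distribʳ-* : ∀ a b n → (a * b) ^ n ≡ a ^ n * b ^ n
^-distribʳ-* a b zero    = refl
^-distribʳ-* a b (suc n) = trans (cong (a * b *_) (^-distribʳ-* a b n)) (arith a b (a ^ n) (b ^ n))
  where
  arith : ∀ a b x y → a * b * (x * y) ≡ a * x * (b * y)
  arith = solve-∀

primesUpTo : ℕ → List ℕ
primesUpTo x = filter prime? (upTo (suc x))

primorial : ℕ → ℕ
primorial x = product (primesUpTo x)

primesUpTo-suc : ∀ x → primesUpTo (suc x) ≡ primesUpTo x ++ filter prime? (suc x ∷ [])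
primesUpTo-suc x = begin
  filter prime? (upTo (suc (suc x)))            ≡⟨ cong (filter prime?) (upTo-∷ʳ (suc x)) ⟨
  filter prime? (upTo (suc x) ++ (suc x ∷ []))  ≡⟨ filter-++ prime? (upTo (suc x)) (suc x ∷ []) ⟩
  primesUpTo x ++ filter prime? (suc x ∷ [])    ∎
  where open ≡-Reasoning

primesUpTo-suc-prime : ∀ {x} → Prime (suc x) → primesUpTo (suc x) ≡ primesUpTo x ++ (suc x ∷ [])
primesUpTo-suc-prime {x} px = trans (primesUpTo-suc x) (cong (primesUpTo x ++_) (filter-accept prime? px))

primesUpTo-suc-¬prime : ∀ {x} → ¬ Prime (suc x) → primesUpTo (suc x) ≡ primesUpTo x
primesUpTo-suc-¬prime {x} ¬px =
  trans (primesUpTo-suc x) (trans (cong (primesUpTo x ++_) (filter-reject prime? ¬px)) (++-identityʳ _))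

primeCount-suc-prime : ∀ {x} → Prime (suc x) → primeCount (suc x) ≡ suc (primeCount x)
primeCount-suc-prime {x} px = begin
  length (primesUpTo (suc x))           ≡⟨ cong length (primesUpTo-suc-prime px) ⟩
  length (primesUpTo x ++ (suc x ∷ [])) ≡⟨ length-++ (primesUpTo x) ⟩
  primeCount x + 1                      ≡⟨ +-comm (primeCount x) 1 ⟩
  suc (primeCount x)                    ∎
  where open ≡-Reasoning

primeCount-suc-¬prime : ∀ {x} → ¬ Prime (suc x) → primeCount (suc x) ≡ primeCount x
primeCount-suc-¬prime ¬px = cong length (primesUpTo-suc-¬prime ¬px)

primorial-suc-prime : ∀ {x} → Prime (suc x) → primorial (suc x) ≡ suc x * primorial x
primorial-suc-prime {x} px = begin
  product (primesUpTo (suc x))           ≡⟨ cong product (primesUpTo-suc-prime px) ⟩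
  product (primesUpTo x ++ (suc x ∷ [])) ≡⟨ product-++ (primesUpTo x) (suc x ∷ []) ⟩
  primorial x * (suc x * 1)              ≡⟨ *-comm (primorial x) (suc x * 1) ⟩
  suc x * 1 * primorial x                ≡⟨ cong (_* primorial x) (*-identityʳ (suc x)) ⟩
  suc x * primorial x                    ∎
  where open ≡-Reasoning

primorial-suc-¬prime : ∀ {x} → ¬ Prime (suc x) → primorial (suc x) ≡ primorial x
primorial-suc-¬prime ¬px = cong product (primesUpTo-suc-¬prime ¬px)

primeCount-suc-≤ : ∀ x → primeCount (suc x) ≤ suc (primeCount x)
primeCount-suc-≤ x with prime? (suc x)
... | yes px  = ≤-reflexive (primeCount-suc-prime px)
... | no  ¬px = ≤-trans (≤-reflexive (primeCount-suc-¬prime ¬px)) (n≤1+n _)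

primeCount-≤-suc : ∀ x → primeCount x ≤ primeCount (suc x)
primeCount-≤-suc x with prime? (suc x)
... | yes px  = ≤-trans (n≤1+n _) (≤-reflexive (sym (primeCount-suc-prime px)))
... | no  ¬px = ≤-reflexive (sym (primeCount-suc-¬prime ¬px))

primeCount-mono-≤ : ∀ {x y} → x ≤ y → primeCount x ≤ primeCount y
primeCount-mono-≤ x≤y = go (≤⇒≤′ x≤y)
  where
  go : ∀ {x y} → x ≤′ y → primeCount x ≤ primeCount y
  go ≤′-refl                     = ≤-refl
  go {y = suc y} (≤′-step x≤′y) = ≤-trans (go x≤′y) (primeCount-≤-suc y)

primeCount<n : ∀ x → 1 ≤ x → primeCount x < x
primeCount<n 1             _ = s≤s z≤n
primeCount<n (suc (suc x)) _ = s≤s (≤-trans (primeCount-suc-≤ (suc x)) (primeCount<n (suc x) (s≤s z≤n)))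

primeCount<primeCount[prime] : ∀ {q x} → Prime q → x < q → primeCount x < primeCount q
primeCount<primeCount[prime] {suc y} pq (s≤s x≤y) =
  ≤-trans (s≤s (primeCount-mono-≤ x≤y)) (≤-reflexive (sym (primeCount-suc-prime pq)))

prime∣primorial⇒≤ : ∀ {q} → Prime q → ∀ x → q ∣ primorial x → q ≤ x
prime∣primorial⇒≤ pq zero    q∣1 = ⊥-elim (prime∤1 pq q∣1)
prime∣primorial⇒≤ {q} pq (suc x) q∣θ with prime? (suc x)
... | no ¬px = m≤n⇒m≤1+n (prime∣primorial⇒≤ pq x (subst (q ∣_) (primorial-suc-¬prime ¬px) q∣θ))
... | yes px with euclidsLemma (suc x) (primorial x) pq (subst (q ∣_) (primorial-suc-prime px) q∣θ)
...   | inj₁ q∣1+x = ∣⇒≤ q∣1+x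
...   | inj₂ q∣θ′  = m≤n⇒m≤1+n (prime∣primorial⇒≤ pq x q∣θ′)

primeCount!≤primorial : ∀ x → suc (primeCount x) ! ≤ primorial x
primeCount!≤primorial zero    = ≤-refl
primeCount!≤primorial (suc x) with prime? (suc x)
... | no ¬px rewrite primeCount-suc-¬prime ¬px | primorial-suc-¬prime ¬px = primeCount!≤primorial x
... | yes px rewrite primeCount-suc-prime px | primorial-suc-prime px =
  *-mono-≤ (s≤s (primeCount<n x (s≤s⁻¹ (prime⇒≥2 px)))) (primeCount!≤primorial x)

primorial>0 : ∀ x → 0 < primorial x
primorial>0 x = ≤-trans (1≤n! (suc (primeCount x))) (primeCount!≤primorial x)

primorial∣primorial*M : ∀ {a b M} → a ≤ b → (∀ q → Prime q → a < q → q ≤ b → q ∣ M) →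
                        primorial b ∣ primorial a * M
primorial∣primorial*M {a} {M = M} a≤b = go (≤⇒≤′ a≤b)
  where
  go : ∀ {b} → a ≤′ b → (∀ q → Prime q → a < q → q ≤ b → q ∣ M) → primorial b ∣ primorial a * M
  go ≤′-refl                _     = m∣m*n M
  go {suc b} (≤′-step a≤′b) primes∣M with prime? (suc b) | go a≤′b primes≤b∣M
    where
    primes≤b∣M : ∀ q → Prime q → a < q → q ≤ b → q ∣ M
    primes≤b∣M q pq a<q q≤b = primes∣M q pq a<q (m≤n⇒m≤1+n q≤b)
  ... | no ¬pb | θb∣θa*M = subst (_∣ primorial a * M) (sym (primorial-suc-¬prime ¬pb)) θb∣θa*M
  ... | yes pb | divides K θa*M≡K*θb =
    subst₂ _∣_ (sym (primorial-suc-prime pb)) (sym θa*M≡K*θb) (*-monoˡ-∣ (primorial b) 1+b∣K)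
    where
    1+b∣K*θb : suc b ∣ K * primorial b
    1+b∣K*θb = subst (suc b ∣_) θa*M≡K*θb (∣n⇒∣m*n (primorial a) (primes∣M (suc b) pb (s≤s (≤′⇒≤ a≤′b)) ≤-refl))
    1+b∣K : suc b ∣ K
    1+b∣K with euclidsLemma K (primorial b) pb 1+b∣K*θb
    ... | inj₁ 1+b∣K  = 1+b∣K
    ... | inj₂ 1+b∣θb = ⊥-elim (1+n≰n (prime∣primorial⇒≤ pb b 1+b∣θb))

[a+b]Ca*[a!*b!]≡[a+b]! : ∀ a b → ((a + b) C a) * (a ! * b !) ≡ (a + b) !
[a+b]Ca*[a!*b!]≡[a+b]! a b = begin
  ((a + b) C a) * (a ! * b !)      ≡⟨ cong (λ c → ((a + b) C a) * (a ! * c !)) (m+n∸m≡n a b) ⟨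
  ((a + b) C a) * d                ≡⟨ cong (_* d) (nCk≡n!/k![n-k]! a≤a+b) ⟩
  (a + b) ! / d * d                ≡⟨ m/n*n≡m (k![n∸k]!∣n! a≤a+b) ⟩
  (a + b) !                        ∎
  where
  open ≡-Reasoning
  a≤a+b = m≤m+n a b
  d = a ! * (a + b ∸ a) !
  instance _ = a !* (a + b ∸ a) !≢0

[a+b]Ca>0 : ∀ a b → 0 < (a + b) C a
[a+b]Ca>0 a b with (a + b) C a | [a+b]Ca*[a!*b!]≡[a+b]! a b
... | zero  | 0≡[a+b]! = ⊥-elim (≢-nonZero⁻¹ _ {{(a + b) !≢0}} (sym 0≡[a+b]!))
... | suc _ | _        = z<s

nCk≤2^n : ∀ n k → n C k ≤ 2 ^ n
nCk≤2^n zero    zero    = ≤-refl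
nCk≤2^n zero    (suc k) = z≤n
nCk≤2^n (suc n) zero    = m^n>0 2 (suc n)
nCk≤2^n (suc n) (suc k) = begin
  suc n C suc k           ≡⟨ nCk+nC[k+1]≡[n+1]C[k+1] n k ⟨
  n C k + n C suc k       ≤⟨ +-mono-≤ (nCk≤2^n n k) (nCk≤2^n n (suc k)) ⟩
  2 ^ n + 2 ^ n           ≡⟨ cong (2 ^ n +_) (+-identityʳ (2 ^ n)) ⟨
  2 ^ suc n               ∎
  where open ≤-Reasoning

nCk≤[1+n]Ck : ∀ n k → n C k ≤ suc n C k
nCk≤[1+n]Ck n zero    = ≤-refl
nCk≤[1+n]Ck n (suc k) = ≤-trans (m≤n+m (n C suc k) (n C k)) (≤-reflexive (nCk+nC[k+1]≡[n+1]C[k+1] n k))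

2^n≤[n+n]Cn : ∀ n → 2 ^ n ≤ (n + n) C n
2^n≤[n+n]Cn zero    = ≤-refl
2^n≤[n+n]Cn (suc n) = begin
  2 ^ suc n                                     ≤⟨ *-monoʳ-≤ 2 (2^n≤[n+n]Cn n) ⟩
  2 * ((n + n) C n)                             ≡⟨ cong ((n + n) C n +_) (+-identityʳ _) ⟩
  (n + n) C n + (n + n) C n                     ≤⟨ +-mono-≤ (nCk≤[1+n]Ck (n + n) n) (m≤m+n _ _) ⟩
  suc (n + n) C n + ((n + n) C n + (n + n) C suc n) ≡⟨ cong (suc (n + n) C n +_) (nCk+nC[k+1]≡[n+1]C[k+1] (n + n) n) ⟩
  suc (n + n) C n + suc (n + n) C suc n         ≡⟨ nCk+nC[k+1]≡[n+1]C[k+1] (suc (n + n)) n ⟩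
  suc (suc (n + n)) C suc n                     ≡⟨ cong (λ m → suc m C suc n) (+-suc n n) ⟨
  (suc n + suc n) C suc n                       ∎
  where open ≤-Reasoning

prime∣[a+b]Ca : ∀ {q a b} → Prime q → a < q → b < q → q ≤ a + b → q ∣ (a + b) C a
prime∣[a+b]Ca {q} {a} {b} pq a<q b<q q≤a+b
  with euclidsLemma ((a + b) C a) (a ! * b !) pq
         (subst (q ∣_) (sym ([a+b]Ca*[a!*b!]≡[a+b]! a b)) (m≤n⇒m∣n! (≤-trans (s≤s z≤n) (prime⇒≥2 pq)) q≤a+b))
... | inj₁ q∣C = q∣C
... | inj₂ q∣a!b! with euclidsLemma (a !) (b !) pq q∣a!b!
...   | inj₁ q∣a! = ⊥-elim (<⇒≱ a<q (prime∣n!⇒≤ pq a q∣a!))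
...   | inj₂ q∣b! = ⊥-elim (<⇒≱ b<q (prime∣n!⇒≤ pq b q∣b!))

primorial[a+b]≤primorial[b]*2^[a+b] : ∀ {a b} → a ≤ b → primorial (a + b) ≤ primorial b * 2 ^ (a + b)
primorial[a+b]≤primorial[b]*2^[a+b] {a} {b} a≤b = begin
  primorial (a + b)              ≤⟨ ∣⇒≤ (primorial∣primorial*M (m≤n+m b a) primes∣C) ⟩
  primorial b * ((a + b) C a)    ≤⟨ *-monoʳ-≤ (primorial b) (nCk≤2^n (a + b) a) ⟩
  primorial b * 2 ^ (a + b)      ∎
  where
  open ≤-Reasoning
  primes∣C : ∀ q → Prime q → b < q → q ≤ a + b → q ∣ (a + b) C a
  primes∣C q pq b<q q≤a+b = prime∣[a+b]Ca pq (≤-<-trans a≤b b<q) b<q q≤a+b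
  instance _ = m*n≢0 (primorial b) ((a + b) C a) {{>-nonZero (primorial>0 b)}} {{>-nonZero ([a+b]Ca>0 a b)}}

⌈n/2⌉≤1+⌊n/2⌋ : ∀ n → ⌈ n /2⌉ ≤ suc ⌊ n /2⌋
⌈n/2⌉≤1+⌊n/2⌋ zero          = z≤n
⌈n/2⌉≤1+⌊n/2⌋ (suc zero)    = ≤-refl
⌈n/2⌉≤1+⌊n/2⌋ (suc (suc n)) = s≤s (⌈n/2⌉≤1+⌊n/2⌋ n)

primorial≤16^n : ∀ x → primorial x ≤ 16 ^ x
primorial≤16^n = <-rec (λ x → primorial x ≤ 16 ^ x) bound
  where
  bound : ∀ x → (∀ {y} → y < x → primorial y ≤ 16 ^ y) → primorial x ≤ 16 ^ x
  bound zero             _   = ≤-refl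
  bound (suc zero)       _   = s≤s z≤n
  bound x@(suc (suc y)) rec = begin
    primorial x               ≡⟨ cong primorial (⌊n/2⌋+⌈n/2⌉≡n x) ⟨
    primorial (a + b)         ≤⟨ primorial[a+b]≤primorial[b]*2^[a+b] (⌊n/2⌋≤⌈n/2⌉ x) ⟩
    primorial b * 2 ^ (a + b) ≤⟨ *-mono-≤ (rec (⌈n/2⌉<n y)) (^-monoʳ-≤ 2 a+b≤4a) ⟩
    16 ^ b * 2 ^ (4 * a)      ≡⟨ cong (16 ^ b *_) (^-*-assoc 2 4 a) ⟨
    16 ^ b * 16 ^ a           ≡⟨ ^-distribˡ-+-* 16 b a ⟨
    16 ^ (b + a)              ≡⟨ cong (16 ^_) (trans (+-comm b a) (⌊n/2⌋+⌈n/2⌉≡n x)) ⟩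
    16 ^ x                    ∎
    where
    open ≤-Reasoning
    a = ⌊ x /2⌋
    b = ⌈ x /2⌉
    a+b≤4a : a + b ≤ 4 * a
    a+b≤4a = ≤-trans (+-monoʳ-≤ a (⌈n/2⌉≤1+⌊n/2⌋ x)) (≤-trans (m≤m+n _ (suc (a′ + a′))) (≤-reflexive (arith a′)))
      where
      a′ = ⌊ y /2⌋
      arith : ∀ k → suc k + suc (suc k) + suc (k + k) ≡ 4 * suc k
      arith = solve-∀

module Legendre {p} (pp : Prime p) where

  instance _ = prime⇒nonZero pp

  -- Legendre's recursion N! = p ^ ⌊N/p⌋ * ⌊N/p⌋! * u with p ∤ u; the field s is ⌊N/p⌋.
  record FactorialSplit (N : ℕ) : Set where
    field
      s u        : ℕ
      s*p≤N      : s * p ≤ N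
      N<[1+s]*p  : N < suc s * p
      N!≡        : N ! ≡ p ^ s * (s ! * u)
      p∤u        : ¬ p ∣ u

  s*p<x<[1+s]*p⇒p∤x : ∀ s x → s * p < x → x < suc s * p → ¬ p ∣ x
  s*p<x<[1+s]*p⇒p∤x s x lo hi (divides q refl) = <⇒≱ (*-cancelʳ-< p q (suc s) hi) (*-cancelʳ-< p s q lo)

  factorialSplit : ∀ N → FactorialSplit N
  factorialSplit zero    = record
    { s = 0 ; u = 1 ; s*p≤N = z≤n ; N<[1+s]*p = ≤-trans (s≤s z≤n) (≤-trans (prime⇒≥2 pp) (m≤m+n p 0))
    ; N!≡ = refl ; p∤u = prime∤1 pp }
  factorialSplit (suc N) with factorialSplit N
  ... | record { s = s ; u = u ; s*p≤N = lo ; N<[1+s]*p = hi ; N!≡ = eq ; p∤u = p∤u } with m≤n⇒m<n∨m≡n hi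
  ...   | inj₁ 1+N<[1+s]*p = record
    { s = s ; u = suc N * u ; s*p≤N = m≤n⇒m≤1+n lo ; N<[1+s]*p = 1+N<[1+s]*p
    ; N!≡ = trans (cong (suc N *_) eq) (arith (suc N) (p ^ s) (s !) u)
    ; p∤u = λ p∣[1+N]*u → [ s*p<x<[1+s]*p⇒p∤x s (suc N) (s≤s lo) 1+N<[1+s]*p , p∤u ]′
                             (euclidsLemma (suc N) u pp p∣[1+N]*u) }
    where
    arith : ∀ x y z w → x * (y * (z * w)) ≡ y * (z * (x * w))
    arith = solve-∀
  ...   | inj₂ 1+N≡[1+s]*p = record
    { s = suc s ; u = u ; s*p≤N = ≤-reflexive (sym 1+N≡[1+s]*p)
    ; N<[1+s]*p = subst (_< suc (suc s) * p) (sym 1+N≡[1+s]*p) (+-monoˡ-< (suc s * p) (≤-trans (s≤s z≤n) (prime⇒≥2 pp)))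
    ; N!≡ = trans (cong (_* N !) 1+N≡[1+s]*p) (trans (cong (suc s * p *_) eq) (arith (suc s) p (p ^ s) (s !) u))
    ; p∤u = p∤u }
    where
    arith : ∀ a p y z w → a * p * (y * (z * w)) ≡ p * y * (a * z * w)
    arith = solve-∀

  open FactorialSplit

  carry : ∀ {a b c} → c ≤ 1 → (A : FactorialSplit a) (B : FactorialSplit b) (S : FactorialSplit (a + b + c)) →
          ∃[ c′ ] (c′ ≤ 1 × s A + s B + c′ ≡ s S)
  carry {a} {b} {c} c≤1 A B S with m≤n⇒∃[o]m+o≡n sA+sB≤sS
    where
    sA+sB≤sS : s A + s B ≤ s S
    sA+sB≤sS = s≤s⁻¹ (*-cancelʳ-< p (s A + s B) (suc (s S)) (begin-strict
      (s A + s B) * p       ≡⟨ *-distribʳ-+ p (s A) (s B) ⟩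
      s A * p + s B * p     ≤⟨ +-mono-≤ (s*p≤N A) (s*p≤N B) ⟩
      a + b                 ≤⟨ m≤m+n (a + b) c ⟩
      a + b + c             <⟨ N<[1+s]*p S ⟩
      suc (s S) * p         ∎))
      where open ≤-Reasoning
  ... | c′ , sA+sB+c′≡sS = c′ , c′≤1 , sA+sB+c′≡sS
    where
    sS<sA+sB+2 : s S < suc (suc (s A + s B))
    sS<sA+sB+2 = *-cancelʳ-< p (s S) (suc (suc (s A + s B))) (begin-strict
      s S * p                      ≤⟨ s*p≤N S ⟩
      a + b + c                    ≤⟨ +-monoʳ-≤ (a + b) c≤1 ⟩
      a + b + 1                    <⟨ ≤-reflexive (arith a b) ⟩
      suc a + suc b                ≤⟨ +-mono-≤ (N<[1+s]*p A) (N<[1+s]*p B) ⟩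
      suc (s A) * p + suc (s B) * p ≡⟨ *-distribʳ-+ p (suc (s A)) (suc (s B)) ⟨
      (suc (s A) + suc (s B)) * p   ≡⟨ cong (λ t → suc t * p) (+-suc (s A) (s B)) ⟩
      suc (suc (s A + s B)) * p    ∎)
      where
      open ≤-Reasoning
      arith : ∀ x y → suc (x + y + 1) ≡ suc x + suc y
      arith = solve-∀
    c′≤1 : c′ ≤ 1
    c′≤1 = s≤s⁻¹ (+-cancelˡ-< (s A + s B) c′ 2 (subst₂ _<_ (sym sA+sB+c′≡sS) (+-comm 2 (s A + s B)) sS<sA+sB+2))

  strip : ∀ {a b c k w c′} (A : FactorialSplit a) (B : FactorialSplit b) (S : FactorialSplit (a + b + c)) →
          s A + s B + c′ ≡ s S → p ^ k * (a ! * b !) ∣ (a + b + c) ! * w →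
          p ^ k * (s A ! * s B !) ∣ p ^ c′ * ((s A + s B + c′) ! * (u S * w))
  strip {a} {b} {c} {k} {w} {c′} A B S sA+sB+c′≡sS dvd =
    m*n∣⇒m∣ _ (u A * u B) (*-cancelˡ-∣ (p ^ (s A + s B)) (subst₂ _∣_ lhs rhs dvd))
    where
    open ≡-Reasoning
    instance _ = m^n≢0 p (s A + s B)
    lhs : p ^ k * (a ! * b !) ≡ p ^ (s A + s B) * (p ^ k * (s A ! * s B !) * (u A * u B))
    lhs = begin
      p ^ k * (a ! * b !)
        ≡⟨ cong₂ (λ x y → p ^ k * (x * y)) (N!≡ A) (N!≡ B) ⟩
      p ^ k * (p ^ s A * (s A ! * u A) * (p ^ s B * (s B ! * u B)))
        ≡⟨ arith (p ^ k) (p ^ s A) (p ^ s B) (s A !) (s B !) (u A) (u B) ⟩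
      p ^ s A * p ^ s B * (p ^ k * (s A ! * s B !) * (u A * u B))
        ≡⟨ cong (_* (p ^ k * (s A ! * s B !) * (u A * u B))) (^-distribˡ-+-* p (s A) (s B)) ⟨
      p ^ (s A + s B) * (p ^ k * (s A ! * s B !) * (u A * u B)) ∎
      where
      arith : ∀ q x y f g u v → q * (x * (f * u) * (y * (g * v))) ≡ x * y * (q * (f * g) * (u * v))
      arith = solve-∀
    rhs : (a + b + c) ! * w ≡ p ^ (s A + s B) * (p ^ c′ * ((s A + s B + c′) ! * (u S * w)))
    rhs = begin
      (a + b + c) ! * w
        ≡⟨ cong (_* w) (N!≡ S) ⟩
      p ^ s S * (s S ! * u S) * w
        ≡⟨ cong (λ t → p ^ t * (t ! * u S) * w) sA+sB+c′≡sS ⟨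
      p ^ (s A + s B + c′) * ((s A + s B + c′) ! * u S) * w
        ≡⟨ cong (λ x → x * ((s A + s B + c′) ! * u S) * w) (^-distribˡ-+-* p (s A + s B) c′) ⟩
      p ^ (s A + s B) * p ^ c′ * ((s A + s B + c′) ! * u S) * w
        ≡⟨ arith (p ^ (s A + s B)) (p ^ c′) ((s A + s B + c′) !) (u S) w ⟩
      p ^ (s A + s B) * (p ^ c′ * ((s A + s B + c′) ! * (u S * w))) ∎
      where
      arith : ∀ x y f u w → x * y * (f * u) * w ≡ x * (y * (f * (u * w)))
      arith = solve-∀

  m*p≤n⇒m<n : ∀ m {n} → 1 ≤ n → m * p ≤ n → m < n
  m*p≤n⇒m<n zero    1≤n _     = 1≤n
  m*p≤n⇒m<n (suc m) _   m*p≤n = <-≤-trans (m<m*n (suc m) p (prime⇒≥2 pp)) m*p≤n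

  private
    KummerBound : ℕ → Set
    KummerBound N = ∀ a b c → a + b + c ≡ N → c ≤ 1 → ∀ k {w} → ¬ p ∣ w →
                    p ^ k * (a ! * b !) ∣ N ! * w → k ≡ 0 ⊎ p ^ k ≤ N

  -- Kummer's theorem, in a form stable under passing to ⌊·/p⌋: a + b + c becomes ⌊a/p⌋ + ⌊b/p⌋ + c′
  -- with a carry c′ ≤ 1, and w collects the factors prime to p.
  kummer-bound : ∀ {a b c} → c ≤ 1 → ∀ k {w} → ¬ p ∣ w →
                 p ^ k * (a ! * b !) ∣ (a + b + c) ! * w → k ≡ 0 ⊎ p ^ k ≤ a + b + c
  kummer-bound {a} {b} {c} = <-rec KummerBound step (a + b + c) a b c refl
    where
    step : ∀ N → (∀ {M} → M < N → KummerBound M) → KummerBound N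
    step _ _   _ _ _ _    _   zero        _   _   = inj₁ refl
    step _ rec a b c refl c≤1 (suc k) {w} p∤w dvd = descend (carry c≤1 A B S)
      where
      A = factorialSplit a
      B = factorialSplit b
      S = factorialSplit (a + b + c)
      lhs = p ^ suc k * (a ! * b !)
      1≤N : 1 ≤ a + b + c
      1≤N = n≢0⇒n>0 λ N≡0 → p∤w (∣-trans (∣m⇒∣m*n (a ! * b !) (m∣m*n (p ^ k)))
                                         (subst (lhs ∣_) (*-identityˡ w) (subst (λ t → lhs ∣ t ! * w) N≡0 dvd)))
      p∤uS*w : ¬ p ∣ u S * w
      p∤uS*w p∣uS*w = [ p∤u S , p∤w ]′ (euclidsLemma (u S) w pp p∣uS*w)
      M*p≤N : ∀ {c′} → s A + s B + c′ ≡ s S → (s A + s B + c′) * p ≤ a + b + c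
      M*p≤N M≡sS = subst (λ t → t * p ≤ a + b + c) (sym M≡sS) (s*p≤N S)
      M<N : ∀ {c′} → s A + s B + c′ ≡ s S → s A + s B + c′ < a + b + c
      M<N M≡sS = m*p≤n⇒m<n _ 1≤N (M*p≤N M≡sS)
      descend : ∃[ c′ ] (c′ ≤ 1 × s A + s B + c′ ≡ s S) → suc k ≡ 0 ⊎ p ^ suc k ≤ a + b + c
      descend (zero , _ , M≡sS) = [ (λ ()) , (λ le → inj₂ (≤-trans le (<⇒≤ (M<N M≡sS)))) ]′ IH
        where
        dvd′ : p ^ suc k * (s A ! * s B !) ∣ (s A + s B + 0) ! * (u S * w)
        dvd′ = subst (p ^ suc k * (s A ! * s B !) ∣_) (*-identityˡ _) (strip {k = suc k} A B S M≡sS dvd)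
        IH : suc k ≡ 0 ⊎ p ^ suc k ≤ s A + s B + 0
        IH = rec (M<N M≡sS) (s A) (s B) 0 refl z≤n (suc k) p∤uS*w dvd′
      descend (suc zero , _ , M≡sS) = inj₂ ([ (λ { refl → p≤N }) , (λ le → ≤-trans (*-monoʳ-≤ p le) p*M≤N) ]′ IH)
        where
        p*M≤N : p * (s A + s B + 1) ≤ a + b + c
        p*M≤N = ≤-trans (≤-reflexive (*-comm p _)) (M*p≤N M≡sS)
        p≤N : p * 1 ≤ a + b + c
        p≤N = ≤-trans (*-monoʳ-≤ p (m≤n+m 1 (s A + s B))) p*M≤N
        dvd′ : p ^ k * (s A ! * s B !) ∣ (s A + s B + 1) ! * (u S * w)
        dvd′ = *-cancelˡ-∣ p (subst₂ _∣_ (*-assoc p (p ^ k) (s A ! * s B !))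
                                         (cong (_* ((s A + s B + 1) ! * (u S * w))) (*-identityʳ p))
                                         (strip {k = suc k} A B S M≡sS dvd))
        IH : k ≡ 0 ⊎ p ^ k ≤ s A + s B + 1
        IH = rec (M<N M≡sS) (s A) (s B) 1 refl ≤-refl k p∤uS*w dvd′
      descend (suc (suc _) , s≤s () , _)

prime-factor : ∀ {N} → 2 ≤ N → ∃[ q ] (Prime q × q ∣ N)
prime-factor {N@(suc _)} 2≤N with factorise N
... | record { factors = [] ; isFactorisation = N≡1 } = ⊥-elim (<⇒≢ 2≤N (sym N≡1))
... | record { factors = q ∷ qs ; isFactorisation = N≡q*qs ; factorsPrime = pq ∷ _ } =
  q , pq , divides (product qs) (trans N≡q*qs (*-comm q (product qs)))

prime-power-split : ∀ {p} → Prime p → ∀ N → 1 ≤ N → ∃[ a ] ∃[ N′ ] (N ≡ p ^ a * N′ × ¬ p ∣ N′)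
prime-power-split {p} pp = <-rec (λ N → 1 ≤ N → ∃[ a ] ∃[ N′ ] (N ≡ p ^ a * N′ × ¬ p ∣ N′)) split
  where
  split : ∀ N → (∀ {M} → M < N → 1 ≤ M → ∃[ a ] ∃[ N′ ] (M ≡ p ^ a * N′ × ¬ p ∣ N′)) →
          1 ≤ N → ∃[ a ] ∃[ N′ ] (N ≡ p ^ a * N′ × ¬ p ∣ N′)
  split N rec 1≤N with p ∣? N
  ... | no p∤N = 0 , N , sym (*-identityˡ N) , p∤N
  ... | yes (divides q N≡q*p) with rec q<N 1≤q
    where
    1≤q : 1 ≤ q
    1≤q = n≢0⇒n>0 λ { refl → <⇒≢ 1≤N (sym N≡q*p) }
    q<N : q < N
    q<N = ≤-trans (m<m*n q p {{>-nonZero 1≤q}} (prime⇒≥2 pp)) (≤-reflexive (sym N≡q*p))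
  ...   | a , N′ , q≡p^a*N′ , p∤N′ = suc a , N′ , N≡p^[1+a]*N′ , p∤N′
    where
    N≡p^[1+a]*N′ : N ≡ p ^ suc a * N′
    N≡p^[1+a]*N′ = begin
      N                ≡⟨ N≡q*p ⟩
      q * p            ≡⟨ cong (_* p) q≡p^a*N′ ⟩
      p ^ a * N′ * p   ≡⟨ arith p (p ^ a) N′ ⟩
      p * p ^ a * N′   ∎
      where
      open ≡-Reasoning
      arith : ∀ p x y → x * y * p ≡ p * x * y
      arith = solve-∀

≤^primeCount : ∀ X {M N} → 1 ≤ N → (∀ q → Prime q → q ∣ N → q ≤ X) →
               (∀ q k → Prime q → q ^ k ∣ N → q ^ k ≤ M) → N ≤ M ^ primeCount X
≤^primeCount zero {N = N} 1≤N factors≤0 _ with m≤n⇒m<n∨m≡n 1≤N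
... | inj₂ 1≡N = ≤-reflexive (sym 1≡N)
... | inj₁ 2≤N with prime-factor 2≤N
...   | q , pq , q∣N = ⊥-elim (<⇒≱ (prime⇒≥2 pq) (≤-trans (factors≤0 q pq q∣N) z≤n))
≤^primeCount (suc X) {M} {N} 1≤N factors≤1+X powers≤M with prime? (suc X)
... | no ¬pX = subst (N ≤_) (cong (M ^_) (sym (primeCount-suc-¬prime ¬pX))) (≤^primeCount X 1≤N factors≤X powers≤M)
  where
  factors≤X : ∀ q → Prime q → q ∣ N → q ≤ X
  factors≤X q pq q∣N = s≤s⁻¹ (≤∧≢⇒< (factors≤1+X q pq q∣N) λ { refl → ¬pX pq })
... | yes pX with prime-power-split pX N 1≤N
...   | a , N′ , N≡ , 1+X∤N′ = subst (N ≤_) (cong (M ^_) (sym (primeCount-suc-prime pX))) (begin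
  N                      ≡⟨ N≡ ⟩
  suc X ^ a * N′         ≤⟨ *-mono-≤ (powers≤M (suc X) a pX (divides N′ (trans N≡ (*-comm _ N′))))
                                     (≤^primeCount X 1≤N′ factors≤X powers′≤M) ⟩
  M * M ^ primeCount X   ∎)
  where
  open ≤-Reasoning
  N′∣N : N′ ∣ N
  N′∣N = divides (suc X ^ a) N≡
  1≤N′ : 1 ≤ N′
  1≤N′ = n≢0⇒n>0 λ { refl → <⇒≢ 1≤N (sym (trans N≡ (*-zeroʳ (suc X ^ a)))) }
  factors≤X : ∀ q → Prime q → q ∣ N′ → q ≤ X
  factors≤X q pq q∣N′ = s≤s⁻¹ (≤∧≢⇒< (factors≤1+X q pq (∣-trans q∣N′ N′∣N)) λ { refl → 1+X∤N′ q∣N′ })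
  powers′≤M : ∀ q k → Prime q → q ^ k ∣ N′ → q ^ k ≤ M
  powers′≤M q k pq q^k∣N′ = powers≤M q k pq (∣-trans q^k∣N′ N′∣N)

2^n≤[n+n]^primeCount[n+n] : ∀ n → 1 ≤ n → 2 ^ n ≤ (n + n) ^ primeCount (n + n)
2^n≤[n+n]^primeCount[n+n] n 1≤n =
  ≤-trans (2^n≤[n+n]Cn n) (≤^primeCount (n + n) ([a+b]Ca>0 n n) factors≤n+n powers≤n+n)
  where
  C∣[n+n]! : (n + n) C n ∣ (n + n) !
  C∣[n+n]! = divides (n ! * n !) (trans (sym ([a+b]Ca*[a!*b!]≡[a+b]! n n)) (*-comm ((n + n) C n) (n ! * n !)))
  factors≤n+n : ∀ q → Prime q → q ∣ (n + n) C n → q ≤ n + n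
  factors≤n+n q pq q∣C = prime∣n!⇒≤ pq (n + n) (∣-trans q∣C C∣[n+n]!)
  powers≤n+n : ∀ q k → Prime q → q ^ k ∣ (n + n) C n → q ^ k ≤ n + n
  powers≤n+n q k pq q^k∣C =
    [ (λ { refl → ≤-trans 1≤n (m≤m+n n n) }) , (λ le → ≤-trans le (≤-reflexive (+-identityʳ (n + n)))) ]′
    (Legendre.kummer-bound pq {n} {n} {0} z≤n k (prime∤1 pq) q^k*n!*n!∣[n+n+0]!*1)
    where
    q^k*n!*n!∣[n+n+0]!*1 : q ^ k * (n ! * n !) ∣ (n + n + 0) ! * 1
    q^k*n!*n!∣[n+n+0]!*1 = subst (q ^ k * (n ! * n !) ∣_)
      (trans ([a+b]Ca*[a!*b!]≡[a+b]! n n) (trans (cong _! (sym (+-identityʳ (n + n)))) (sym (*-identityʳ _))))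
      (*-monoˡ-∣ (n ! * n !) q^k∣C)

8*[1+n]≤2^n : ∀ {n} → 6 ≤ n → 8 * suc n ≤ 2 ^ n
8*[1+n]≤2^n 6≤n = go (≤⇒≤′ 6≤n)
  where
  go : ∀ {n} → 6 ≤′ n → 8 * suc n ≤ 2 ^ n
  go ≤′-refl                = ≤ᵇ⇒≤ 56 64 _
  go {suc n} (≤′-step 6≤′n) = begin
    8 * suc (suc n)  ≡⟨ *-suc 8 (suc n) ⟩
    8 + 8 * suc n    ≤⟨ +-mono-≤ (≤-trans (m≤m*n 8 (suc n)) (go 6≤′n)) (go 6≤′n) ⟩
    2 ^ n + 2 ^ n    ≡⟨ cong (2 ^ n +_) (+-identityʳ (2 ^ n)) ⟨
    2 ^ suc n        ∎
    where open ≤-Reasoning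

log₂-witness : ∀ {j} → 64 ≤ j → ∃[ e ] (j < 2 ^ e × 8 * e ≤ j)
log₂-witness 64≤j with go (≤⇒≤′ 64≤j)
  where
  go : ∀ {j} → 64 ≤′ j → ∃[ e ] (6 ≤ e × j < 2 ^ e × 8 * e ≤ j)
  go ≤′-refl = 7 , ≤ᵇ⇒≤ 6 7 _ , ≤ᵇ⇒≤ 65 128 _ , ≤ᵇ⇒≤ 56 64 _
  go {suc j} (≤′-step 64≤′j) with go 64≤′j
  ... | e , 6≤e , j<2^e , 8e≤j with m≤n⇒m<n∨m≡n j<2^e
  ...   | inj₁ 1+j<2^e = e , 6≤e , 1+j<2^e , m≤n⇒m≤1+n 8e≤j
  ...   | inj₂ 1+j≡2^e = suc e , m≤n⇒m≤1+n 6≤e ,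
                         subst (_< 2 ^ suc e) (sym 1+j≡2^e) (^-monoʳ-< 2 ≤-refl (n<1+n e)) ,
                         subst (8 * suc e ≤_) (sym 1+j≡2^e) (8*[1+n]≤2^n 6≤e)
... | e , _ , j<2^e , 8e≤j = e , j<2^e , 8e≤j

-- With u = 2(c+1) and j = s·u + r: j! ≥ (s+1)^(j-s) while j ≤ u(s+1), and u^u ≤ s+1 absorbs u^(cj).
n^[c*n]≤[n!]^[1+c] : ∀ c {j} → 2 * suc c * (2 * suc c) ^ (2 * suc c) ≤ j → j ^ (c * j) ≤ (j !) ^ suc c
n^[c*n]≤[n!]^[1+c] c {j} j≥ =
  subst (λ j → j ^ (c * j) ≤ (j !) ^ suc c) (sym (m≡m%n+[m/n]*n j u)) (decomposed (m%n<n j u) u^u≤j/u)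
  where
  u = 2 * suc c
  u+s*u≡u*[1+s] : ∀ s → u + s * u ≡ u * suc s
  u+s*u≡u*[1+s] s = trans (cong (u +_) (*-comm s u)) (sym (*-suc u s))
  u^u≤j/u : u ^ u ≤ j / u
  u^u≤j/u = ≮⇒≥ λ j/u<u^u → <⇒≱ (begin-strict
    j                     ≡⟨ m≡m%n+[m/n]*n j u ⟩
    j % u + j / u * u     <⟨ +-monoˡ-< (j / u * u) (m%n<n j u) ⟩
    u + j / u * u         ≡⟨ u+s*u≡u*[1+s] (j / u) ⟩
    u * suc (j / u)       ≤⟨ *-monoʳ-≤ u j/u<u^u ⟩
    u * u ^ u             ∎) j≥
    where open ≤-Reasoning
  decomposed : ∀ {r s} → r < u → u ^ u ≤ s → (r + s * u) ^ (c * (r + s * u)) ≤ ((r + s * u) !) ^ suc c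
  decomposed {r} {s} r<u u^u≤s = begin
    m ^ (c * m)                   ≤⟨ ^-monoˡ-≤ (c * m) m≤u*[1+s] ⟩
    (u * suc s) ^ (c * m)         ≡⟨ ^-distribʳ-* u (suc s) (c * m) ⟩
    u ^ (c * m) * suc s ^ (c * m) ≤⟨ *-monoˡ-≤ (suc s ^ (c * m)) u^[c*m]≤[1+s]^E ⟩
    suc s ^ E * suc s ^ (c * m)   ≡⟨ ^-distribˡ-+-* (suc s) E (c * m) ⟨
    suc s ^ (E + c * m)           ≡⟨ cong (suc s ^_) (arith c s r) ⟩
    suc s ^ (d * suc c)           ≡⟨ ^-*-assoc (suc s) d (suc c) ⟨
    (suc s ^ d) ^ suc c           ≤⟨ ^-monoˡ-≤ (suc c) ([1+s]^d≤[s+d]! s d) ⟩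
    ((s + d) !) ^ suc c           ≡⟨ cong (λ n → (n !) ^ suc c) (arith′ c s r) ⟩
    (m !) ^ suc c                 ∎
    where
    open ≤-Reasoning
    m = r + s * u
    d = r + s * (2 * c + 1)
    E = suc c * s + r
    arith : ∀ c s r → suc c * s + r + c * (r + s * (2 * suc c)) ≡ (r + s * (2 * c + 1)) * suc c
    arith = solve-∀
    arith′ : ∀ c s r → s + (r + s * (2 * c + 1)) ≡ r + s * (2 * suc c)
    arith′ = solve-∀
    m≤u*[1+s] : m ≤ u * suc s
    m≤u*[1+s] = ≤-trans (+-monoˡ-≤ (s * u) (<⇒≤ r<u)) (≤-reflexive (u+s*u≡u*[1+s] s))
    c*m≤u*E : c * m ≤ u * E
    c*m≤u*E = ≤-trans (m≤m+n (c * m) (suc (suc c) * r + u * s)) (≤-reflexive (arith″ c s r))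
      where
      arith″ : ∀ c s r → c * (r + s * (2 * suc c)) + (suc (suc c) * r + 2 * suc c * s) ≡ 2 * suc c * (suc c * s + r)
      arith″ = solve-∀
    u^[c*m]≤[1+s]^E : u ^ (c * m) ≤ suc s ^ E
    u^[c*m]≤[1+s]^E = begin
      u ^ (c * m)   ≤⟨ ^-monoʳ-≤ u c*m≤u*E ⟩
      u ^ (u * E)   ≡⟨ ^-*-assoc u u E ⟨
      (u ^ u) ^ E   ≤⟨ ^-monoˡ-≤ E (≤-trans u^u≤s (n≤1+n s)) ⟩
      suc s ^ E     ∎

[2n+1]*b≤[2b+1]*n : ∀ {b n} → b ≤ n → (2 * n + 1) * b ≤ (2 * b + 1) * n
[2n+1]*b≤[2b+1]*n {b} b≤n with m≤n⇒∃[o]m+o≡n b≤n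
... | t , refl = ≤-trans (m≤m+n _ t) (≤-reflexive (arith b t))
  where
  arith : ∀ b t → (2 * (b + t) + 1) * b + t ≡ (2 * b + 1) * (b + t)
  arith = solve-∀

module NthPrime (P : ℕ → ℕ) (isNthPrime : ∀ n → 1 ≤ n → IsNthPrime n (P n)) where

  P-prime : ∀ {m} → 1 ≤ m → Prime (P m)
  P-prime {m} 1≤m = proj₁ (isNthPrime m 1≤m)

  primeCount[P] : ∀ {m} → 1 ≤ m → primeCount (P m) ≡ m
  primeCount[P] {m} 1≤m = proj₂ (isNthPrime m 1≤m)

  n<P[n] : ∀ {m} → 1 ≤ m → m < P m
  n<P[n] {m} 1≤m = subst (_< P m) (primeCount[P] 1≤m) (primeCount<n (P m) (≤-trans (s≤s z≤n) (prime⇒≥2 (P-prime 1≤m))))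

  P-least : ∀ {m x} → 1 ≤ m → m ≤ primeCount x → P m ≤ x
  P-least {m} {x} 1≤m m≤πx = ≮⇒≥ λ x<Pm →
    <⇒≱ (subst (primeCount x <_) (primeCount[P] 1≤m) (primeCount<primeCount[prime] (P-prime 1≤m) x<Pm)) m≤πx

  [1+n]!≤16^P[n] : ∀ {m} → 1 ≤ m → suc m ! ≤ 16 ^ P m
  [1+n]!≤16^P[n] {m} 1≤m = begin
    suc m !                    ≡⟨ cong (λ k → suc k !) (primeCount[P] 1≤m) ⟨
    suc (primeCount (P m)) !   ≤⟨ primeCount!≤primorial (P m) ⟩
    primorial (P m)            ≤⟨ primorial≤16^n (P m) ⟩
    16 ^ P m                   ∎
    where open ≤-Reasoning

  -- (m+1)! ≥ s^(m+1-s) with s = 256^t = 16^(2t), against (m+1)! ≤ 16^(P m).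
  t*n≤P[n] : ∀ t {m} → 2 * 256 ^ t ≤ m → t * m ≤ P m
  t*n≤P[n] t 2s≤m with m≤n⇒∃[o]m+o≡n 2s≤m
  ... | r , refl = ^-cancelˡ-≤ 16 (s≤s (s≤s z≤n)) (begin
    16 ^ (t * (2 * s + r))          ≤⟨ ^-monoʳ-≤ 16 (≤-trans (m≤m+n _ (t * (r + 2))) (≤-reflexive (arith t s r))) ⟩
    16 ^ (2 * t * suc (s + r))      ≡⟨ ^-*-assoc 16 (2 * t) (suc (s + r)) ⟨
    (16 ^ (2 * t)) ^ suc (s + r)    ≡⟨ cong (_^ suc (s + r)) (^-*-assoc 16 2 t) ⟨
    s ^ suc (s + r)                 ≤⟨ ^-monoˡ-≤ (suc (s + r)) (n≤1+n s) ⟩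
    suc s ^ suc (s + r)             ≤⟨ [1+s]^d≤[s+d]! s (suc (s + r)) ⟩
    (s + suc (s + r)) !             ≡⟨ cong _! (arith′ s r) ⟩
    suc (2 * s + r) !               ≤⟨ [1+n]!≤16^P[n] 1≤2s+r ⟩
    16 ^ P (2 * s + r)              ∎)
    where
    open ≤-Reasoning
    s = 256 ^ t
    1≤2s+r : 1 ≤ 2 * s + r
    1≤2s+r = ≤-trans (m^n>0 256 t) (≤-trans (m≤m+n s (s + 0)) (m≤m+n (2 * s) r))
    arith : ∀ t s r → t * (2 * s + r) + t * (r + 2) ≡ 2 * t * suc (s + r)
    arith = solve-∀
    arith′ : ∀ s r → s + suc (s + r) ≡ suc (2 * s + r)
    arith′ = solve-∀

  -- Chebyshev's bound π(x) ≥ x / (2 log₂ x) at x = m·2L, read as an upper bound for p_m.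
  P[n]≤n*[2L] : ∀ {m L} → 1 ≤ m → 1 ≤ L → m * (2 * L) ≤ 2 ^ L → P m ≤ m * (2 * L)
  P[n]≤n*[2L] {m} {L} 1≤m 1≤L x≤2^L = P-least 1≤m (*-cancelʳ-≤ m π L {{>-nonZero 1≤L}} (^-cancelˡ-≤ 2 ≤-refl (begin
    2 ^ (m * L)                          ≤⟨ subst (λ y → 2 ^ (m * L) ≤ y ^ primeCount y) (double m L)
                                              (2^n≤[n+n]^primeCount[n+n] (m * L) (*-mono-≤ 1≤m 1≤L)) ⟩
    x ^ π                                ≤⟨ ^-monoˡ-≤ π x≤2^L ⟩
    (2 ^ L) ^ π                          ≡⟨ ^-*-assoc 2 L π ⟩
    2 ^ (L * π)                          ≡⟨ cong (2 ^_) (*-comm L π) ⟩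
    2 ^ (π * L)                          ∎)))
    where
    open ≤-Reasoning
    x = m * (2 * L)
    π = primeCount x
    double : ∀ m L → m * L + m * L ≡ m * (2 * L)
    double = solve-∀

  iter-≥ : ∀ {j} → 1 ≤ j → ∀ k → j ≤ iter P k j
  iter-≥ 1≤j zero    = ≤-refl
  iter-≥ 1≤j (suc k) = <⇒≤ (≤-<-trans (iter-≥ 1≤j k) (n<P[n] (≤-trans 1≤j (iter-≥ 1≤j k))))

  -- From k = 255 on, the factor k + 1 gained by t*n≤P[n] also pays for the next factor 256.
  iter-growth-step : ∀ {k m} → 255 ≤ k → k ! ≤ m → 2 * 256 ^ suc k ≤ m →
                     suc k ! ≤ P m × 2 * 256 ^ suc (suc k) ≤ P m
  iter-growth-step {k} {m} 255≤k k!≤m 2*256^[1+k]≤m = ≤-trans (*-monoʳ-≤ (suc k) k!≤m) [1+k]*m≤Pm , (begin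
    2 * (256 * 256 ^ suc k)     ≡⟨ x∙yz≈y∙xz 2 256 (256 ^ suc k) ⟩
    256 * (2 * 256 ^ suc k)     ≤⟨ *-mono-≤ (s≤s 255≤k) 2*256^[1+k]≤m ⟩
    suc k * m                   ≤⟨ [1+k]*m≤Pm ⟩
    P m                         ∎)
    where
    open ≤-Reasoning
    [1+k]*m≤Pm : suc k * m ≤ P m
    [1+k]*m≤Pm = t*n≤P[n] (suc k) 2*256^[1+k]≤m

  iter-threshold : ℕ
  iter-threshold = 255 ! + 2 * 256 ^ 256

  n!≤iter : ∀ {j} → iter-threshold ≤ j → j ! ≤ iter P j j
  n!≤iter {j} j≥ = subst (λ k → k ! ≤ iter P k j) (m∸n+n≡m 255≤j) (proj₁ (invariant (j ∸ 255)))
    where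
    j≥255! : 255 ! ≤ j
    j≥255! = ≤-trans (m≤m+n (255 !) (2 * 256 ^ 256)) j≥
    255≤j : 255 ≤ j
    255≤j = ≤-trans (≤ᵇ⇒≤ 255 (255 !) _) j≥255!
    invariant : ∀ d → (d + 255) ! ≤ iter P (d + 255) j × 2 * 256 ^ suc (d + 255) ≤ iter P (d + 255) j
    invariant zero    = ≤-trans j≥255! (iter-≥ 1≤j 255) , ≤-trans (≤-trans (m≤n+m _ (255 !)) j≥) (iter-≥ 1≤j 255)
      where
      1≤j : 1 ≤ j
      1≤j = ≤-trans (1≤n! 255) j≥255!
    invariant (suc d) = iter-growth-step (m≤n+m 255 d) (proj₁ (invariant d)) (proj₂ (invariant d))

  -- L = e(2j+4) gives m·2L ≤ 2^L for m ≤ j^(2j+1) < 2^(e(2j+1)), and 2L ≤ j² by 8e ≤ j.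
  module _ {j e} (1≤j : 1 ≤ j) (j<2^e : j < 2 ^ e) (8e≤j : 8 * e ≤ j) where

    private
      instance _ = >-nonZero 1≤j

      L : ℕ
      L = e * (2 * j + 4)

      1≤e : 1 ≤ e
      1≤e = n≢0⇒n>0 λ { refl → <⇒≱ j<2^e 1≤j }

      2L≤j*j : 2 * L ≤ j * j
      2L≤j*j = *-cancelˡ-≤ 4 (begin
        4 * (2 * L)              ≡⟨ arith e j ⟩
        8 * e * (2 * j + 4)      ≤⟨ *-monoˡ-≤ (2 * j + 4) 8e≤j ⟩
        j * (2 * j + 4)          ≤⟨ *-monoʳ-≤ j (+-monoʳ-≤ (2 * j) (*-monoʳ-≤ 2 2≤j)) ⟩
        j * (2 * j + 2 * j)      ≡⟨ arith′ j ⟩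
        4 * (j * j)              ∎)
        where
        open ≤-Reasoning
        2≤j : 2 ≤ j
        2≤j = ≤-trans (s≤s (s≤s z≤n)) (≤-trans (*-monoʳ-≤ 8 1≤e) 8e≤j)
        arith : ∀ e j → 4 * (2 * (e * (2 * j + 4))) ≡ 8 * e * (2 * j + 4)
        arith = solve-∀
        arith′ : ∀ j → j * (2 * j + 2 * j) ≡ 4 * (j * j)
        arith′ = solve-∀

      ^*square : ∀ n → j ^ n * (j * j) ≡ j ^ (2 + n)
      ^*square n = trans (*-comm (j ^ n) (j * j)) (*-assoc j j (j ^ n))

    P[n]≤n*[j*j] : ∀ {m} → 1 ≤ m → m ≤ j ^ (2 * j + 1) → P m ≤ m * (j * j)
    P[n]≤n*[j*j] {m} 1≤m m≤j^[2j+1] = ≤-trans (P[n]≤n*[2L] 1≤m 1≤L m*2L≤2^L) (*-monoʳ-≤ m 2L≤j*j)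
      where
      open ≤-Reasoning
      1≤L : 1 ≤ L
      1≤L = *-mono-≤ 1≤e (≤-trans (s≤s z≤n) (m≤n+m 4 (2 * j)))
      m*2L≤2^L : m * (2 * L) ≤ 2 ^ L
      m*2L≤2^L = begin
        m * (2 * L)                ≤⟨ *-mono-≤ m≤j^[2j+1] 2L≤j*j ⟩
        j ^ (2 * j + 1) * (j * j)  ≡⟨ ^*square (2 * j + 1) ⟩
        j ^ (2 + (2 * j + 1))      ≤⟨ ^-monoˡ-≤ (2 + (2 * j + 1)) (<⇒≤ j<2^e) ⟩
        (2 ^ e) ^ (2 + (2 * j + 1)) ≡⟨ ^-*-assoc 2 e (2 + (2 * j + 1)) ⟩
        2 ^ (e * (2 + (2 * j + 1))) ≡⟨ cong (λ x → 2 ^ (e * x)) (arith j) ⟩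
        2 ^ (e * (2 * j + 3))      ≤⟨ ^-monoʳ-≤ 2 (*-monoʳ-≤ e (+-monoʳ-≤ (2 * j) (n≤1+n 3))) ⟩
        2 ^ L                      ∎
        where
        arith : ∀ j → 2 + (2 * j + 1) ≡ 2 * j + 3
        arith = solve-∀

    iter-≤ : ∀ k → k ≤ j → iter P k j ≤ j ^ (2 * k + 1)
    iter-≤ zero    _     = ≤-reflexive (sym (*-identityʳ j))
    iter-≤ (suc k) 1+k≤j = begin
      P (iter P k j)             ≤⟨ P[n]≤n*[j*j] (≤-trans 1≤j (iter-≥ 1≤j k)) (≤-trans IH j^[2k+1]≤j^[2j+1]) ⟩
      iter P k j * (j * j)       ≤⟨ *-monoˡ-≤ (j * j) IH ⟩
      j ^ (2 * k + 1) * (j * j)  ≡⟨ ^*square (2 * k + 1) ⟩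
      j ^ (2 + (2 * k + 1))      ≡⟨ cong (j ^_) (arith k) ⟩
      j ^ (2 * suc k + 1)        ∎
      where
      open ≤-Reasoning
      k≤j : k ≤ j
      k≤j = ≤-trans (n≤1+n k) 1+k≤j
      IH : iter P k j ≤ j ^ (2 * k + 1)
      IH = iter-≤ k k≤j
      j^[2k+1]≤j^[2j+1] : j ^ (2 * k + 1) ≤ j ^ (2 * j + 1)
      j^[2k+1]≤j^[2j+1] = ^-monoʳ-≤ j (+-monoˡ-≤ 1 (*-monoʳ-≤ 2 k≤j))
      arith : ∀ k → 2 + (2 * k + 1) ≡ 2 * suc k + 1
      arith = solve-∀

corollary12 : (P : ℕ → ℕ) → (∀ n → 1 ≤ n → IsNthPrime n (P n)) →
    ((b : ℕ) → 1 ≤ b → ∃[ N ] (∀ j → N ≤ j → j ^ ((b ∸ 1) * j) ≤ iter P j j ^ b))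
    × ((b : ℕ) → 1 ≤ b → ∃[ N ] (∀ j → N ≤ j → iter P j j ^ b ≤ j ^ ((2 * b + 1) * j)))
corollary12 P isNthPrime = lower , upper
  where
  open NthPrime P isNthPrime
  lower : (b : ℕ) → 1 ≤ b → ∃[ N ] (∀ j → N ≤ j → j ^ ((b ∸ 1) * j) ≤ iter P j j ^ b)
  lower (suc c) _ = U + iter-threshold , λ j N≤j →
    ≤-trans (n^[c*n]≤[n!]^[1+c] c (≤-trans (m≤m+n U iter-threshold) N≤j))
            (^-monoˡ-≤ (suc c) (n!≤iter (≤-trans (m≤n+m iter-threshold U) N≤j)))
    where
    U = 2 * suc c * (2 * suc c) ^ (2 * suc c)
  upper : (b : ℕ) → 1 ≤ b → ∃[ N ] (∀ j → N ≤ j → iter P j j ^ b ≤ j ^ ((2 * b + 1) * j))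
  upper b _ = 64 + b , bound
    where
    bound : ∀ j → 64 + b ≤ j → iter P j j ^ b ≤ j ^ ((2 * b + 1) * j)
    bound j N≤j with log₂-witness (≤-trans (m≤m+n 64 b) N≤j)
    ... | e , j<2^e , 8e≤j = begin
      iter P j j ^ b          ≤⟨ ^-monoˡ-≤ b (iter-≤ {j} {e} 1≤j j<2^e 8e≤j j ≤-refl) ⟩
      (j ^ (2 * j + 1)) ^ b   ≡⟨ ^-*-assoc j (2 * j + 1) b ⟩
      j ^ ((2 * j + 1) * b)   ≤⟨ ^-monoʳ-≤ j {{>-nonZero 1≤j}} ([2n+1]*b≤[2b+1]*n (≤-trans (m≤n+m b 64) N≤j)) ⟩
      j ^ ((2 * b + 1) * j)   ∎
      where
      open ≤-Reasoning
      1≤j : 1 ≤ j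
      1≤j = ≤-trans (s≤s z≤n) (≤-trans (m≤m+n 64 b) N≤j)
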